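{- Let $G=(V,E)$ be a finite undirected graph with $n$ vertices, and let $k\ge 2$ be an integer with $\lfloor k/2\rfloor\le n$, such that every odd cycle in $G$ has length greater than $2k+1$. Then there is a set $X\subseteq V$ with $$|X|\le \frac{n}{\lfloor k/2\rfloor}\ln\frac{n}{\lfloor k/2\rfloor}$$ such that the graph obtained from $G$ by deleting the vertices of $X$ is bipartite. -}

module Defs where

open import Data.Nat using (ℕ; zero; suc; _+_; _*_; _<_)
open import Data.Integer using (+_)
open import Data.Rational using (ℚ; _/_; 0ℚ; 1ℚ) renaming (_+_ to _+ℚ_; _*_ to _*ℚ_; _≤_ to _≤ℚ_)
open import Data.Fin using (Fin; zero; suc; inject₁; fromℕ)
open import Data.Product using (Σ; ∃; _×_)
open import Data.Empty using (⊥)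
open import Relation.Nullary using (Dec; ¬_)
open import Relation.Binary.PropositionalEquality using (_≡_)
open import Function.Definitions using (Injective)

record Graph (n : ℕ) : Set₁ where
  field
    Adj     : Fin n → Fin n → Set
    adj?    : ∀ u v → Dec (Adj u v)
    sym     : ∀ {u v} → Adj u v → Adj v u
    irrefl  : ∀ {u} → ¬ Adj u u
open Graph public

record Cycle {n : ℕ} (G : Graph n) (len : ℕ) : Set where
  field
    m        : ℕ
    len≡     : len ≡ suc m
    len≥3    : 2 < len
    vert     : Fin (suc m) → Fin n
    distinct : Injective _≡_ _≡_ vert
    step     : ∀ (i : Fin m) → Adj G (vert (inject₁ i)) (vert (suc i))
    close    : Adj G (vert (fromℕ m)) (vert zero)

Odd : ℕ → Set
Odd L = ∃ λ j → L ≡ suc (2 * j)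

expTerm : ℚ → ℕ → ℚ
expTerm x zero    = 1ℚ
expTerm x (suc i) = (expTerm x i *ℚ x) *ℚ ((+ 1) / suc i)

expPartial : ℚ → ℕ → ℚ
expPartial x zero    = 0ℚ
expPartial x (suc N) = expPartial x N +ℚ expTerm x N

-- LnBound s n m  expresses the real inequality  s ≤ (n/m) · ln(n/m)
-- (for n, m ≥ 1), equivalently exp(s·m/n) ≤ n/m, i.e. every partial
-- sum of the exponential series at s·m/n is ≤ n/m.
-- The cases n = 0 or m = 0 (where the expression is undefined) never
-- arise under the theorem's hypotheses; they are set to ⊥.
LnBound : ℕ → ℕ → ℕ → Set
LnBound s zero    m       = ⊥
LnBound s (suc n) zero    = ⊥
LnBound s (suc n) (suc m) =
  ∀ (N : ℕ) → expPartial ((+ (s * suc m)) / suc n) N ≤ℚ ((+ suc n) / suc m)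

{-# OPTIONS --safe #-}

-- Let m = ⌊k/2⌋. Pick a vertex v of the remaining vertex set A and grow the balls B_j around v
-- in G[A]. They grow strictly up to radius m, so |B_m| > m; hence some radius m ≤ r < 2m has
-- |B_{r+1}| ≤ (n/m)^(1/m) |B_r|, since otherwise |B_2m| > (n/m) |B_m| > n. With no odd cycle of
-- length at most 2r + 1, B_r is bipartite, coloured by the parity of the depth. Keep B_r, delete
-- the sphere B_{r+1} - B_r, which separates B_r from the rest, and recurse on A - B_{r+1}. In
-- total at least (m/n)^(1/m) n vertices are kept, so the deleted set X satisfies
-- (1 - |X|/n)^m ≥ m/n, and exp (|X| m/n) ≤ (1 - |X|/n)^-m ≤ n/m.

module Submission where

module ExponentialSeries where

  open import Data.Nat as ℕ using (ℕ; zero; suc)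
  import Data.Nat.Properties as ℕ
  open import Data.Integer as ℤ using (+_)
  import Data.Integer.Properties as ℤ
  open import Data.Rational
  open import Data.Rational.Properties
  import Data.Rational.Unnormalised as ℚᵘ
  import Data.Rational.Unnormalised.Properties as ℚᵘ
  open import Data.Rational.Solver using (module +-*-Solver)
  import Data.Integer.Solver as ℤSolver
  open import Algebra.Definitions.RawSemiring +-*-rawSemiring using (_^_)
  open import Relation.Binary.PropositionalEquality
  open import Relation.Nullary using (contradiction)
  open import Defs using (expTerm; expPartial; LnBound)

  fromℕ : ℕ → ℚ
  fromℕ k = + k / 1

  private
    toℚᵘ-/ : ∀ a p .{{_ : ℕ.NonZero p}} → toℚᵘ (+ a / p) ℚᵘ.≃ ℚᵘ.mkℚᵘ (+ a) (ℕ.pred p)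
    toℚᵘ-/ a (suc p) = toℚᵘ-fromℚᵘ (ℚᵘ.mkℚᵘ (+ a) p)

  /-≡ : ∀ a b p q .{{_ : ℕ.NonZero p}} .{{_ : ℕ.NonZero q}} →
        a ℕ.* q ≡ b ℕ.* p → + a / p ≡ + b / q
  /-≡ a b p@(suc _) q@(suc _) eq = toℚᵘ-injective
    (ℚᵘ.≃-trans (toℚᵘ-/ a p) (ℚᵘ.≃-trans (ℚᵘ.*≡* eqℤ) (ℚᵘ.≃-sym (toℚᵘ-/ b q))))
    where
    eqℤ : + a ℤ.* + q ≡ + b ℤ.* + p
    eqℤ = trans (sym (ℤ.pos-* a q)) (trans (cong +_ eq) (ℤ.pos-* b p))

  /-≤ : ∀ a b p q .{{_ : ℕ.NonZero p}} .{{_ : ℕ.NonZero q}} →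
        a ℕ.* q ℕ.≤ b ℕ.* p → + a / p ≤ + b / q
  /-≤ a b p@(suc _) q@(suc _) le = toℚᵘ-cancel-≤
    (ℚᵘ.≤-respˡ-≃ (ℚᵘ.≃-sym (toℚᵘ-/ a p)) (ℚᵘ.≤-respʳ-≃ (ℚᵘ.≃-sym (toℚᵘ-/ b q)) (ℚᵘ.*≤* leℤ)))
    where
    leℤ : + a ℤ.* + q ℤ.≤ + b ℤ.* + p
    leℤ = subst₂ ℤ._≤_ (ℤ.pos-* a q) (ℤ.pos-* b p) (ℤ.+≤+ le)

  /-< : ∀ a b p q .{{_ : ℕ.NonZero p}} .{{_ : ℕ.NonZero q}} →
        a ℕ.* q ℕ.< b ℕ.* p → + a / p < + b / q
  /-< a b p@(suc _) q@(suc _) lt = toℚᵘ-cancel-<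
    (ℚᵘ.<-respˡ-≃ (ℚᵘ.≃-sym (toℚᵘ-/ a p)) (ℚᵘ.<-respʳ-≃ (ℚᵘ.≃-sym (toℚᵘ-/ b q)) (ℚᵘ.*<* ltℤ)))
    where
    ltℤ : + a ℤ.* + q ℤ.< + b ℤ.* + p
    ltℤ = subst₂ ℤ._<_ (ℤ.pos-* a q) (ℤ.pos-* b p) (ℤ.+<+ lt)

  /-* : ∀ a b p q .{{_ : ℕ.NonZero p}} .{{_ : ℕ.NonZero q}} →
        (+ a / p) * (+ b / q) ≡ (+ (a ℕ.* b) / (p ℕ.* q)) {{ℕ.m*n≢0 p q}}
  /-* a b p@(suc _) q@(suc _) = toℚᵘ-injective (begin-equality
    toℚᵘ ((+ a / p) * (+ b / q))          ≃⟨ toℚᵘ-homo-* (+ a / p) (+ b / q) ⟩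
    toℚᵘ (+ a / p) ℚᵘ.* toℚᵘ (+ b / q)   ≃⟨ ℚᵘ.*-cong (toℚᵘ-/ a p) (toℚᵘ-/ b q) ⟩
    ℚᵘ.mkℚᵘ (+ a ℤ.* + b) (ℕ.pred (p ℕ.* q)) ≡⟨ cong (λ x → ℚᵘ.mkℚᵘ x _) (sym (ℤ.pos-* a b)) ⟩
    ℚᵘ.mkℚᵘ (+ (a ℕ.* b)) (ℕ.pred (p ℕ.* q)) ≃⟨ ℚᵘ.≃-sym (toℚᵘ-/ (a ℕ.* b) (p ℕ.* q)) ⟩
    toℚᵘ (+ (a ℕ.* b) / (p ℕ.* q)) ∎)
    where open ℚᵘ.≤-Reasoning

  /-+ : ∀ a b d .{{_ : ℕ.NonZero d}} → (+ a / d) + (+ b / d) ≡ + (a ℕ.+ b) / d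
  /-+ a b d@(suc _) = toℚᵘ-injective (begin-equality
    toℚᵘ ((+ a / d) + (+ b / d))          ≃⟨ toℚᵘ-homo-+ (+ a / d) (+ b / d) ⟩
    toℚᵘ (+ a / d) ℚᵘ.+ toℚᵘ (+ b / d)   ≃⟨ ℚᵘ.+-cong (toℚᵘ-/ a d) (toℚᵘ-/ b d) ⟩
    ℚᵘ.mkℚᵘ (+ a) (ℕ.pred d) ℚᵘ.+ ℚᵘ.mkℚᵘ (+ b) (ℕ.pred d) ≃⟨ ℚᵘ.*≡* eqℤ ⟩
    ℚᵘ.mkℚᵘ (+ (a ℕ.+ b)) (ℕ.pred d)     ≃⟨ ℚᵘ.≃-sym (toℚᵘ-/ (a ℕ.+ b) d) ⟩
    toℚᵘ (+ (a ℕ.+ b) / d) ∎)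
    where
    open ℚᵘ.≤-Reasoning
    open ℤSolver.+-*-Solver
    eqℤ : (+ a ℤ.* + d ℤ.+ + b ℤ.* + d) ℤ.* + d ≡ + (a ℕ.+ b) ℤ.* (+ d ℤ.* + d)
    eqℤ = trans (solve 3 (λ x y z → (x :* z :+ y :* z) :* z := (x :+ y) :* (z :* z)) refl (+ a) (+ b) (+ d))
                (cong (ℤ._* (+ d ℤ.* + d)) (sym (ℤ.pos-+ a b)))

  /-^ : ∀ a p .{{_ : ℕ.NonZero p}} i → (+ a / p) ^ i ≡ (+ (a ℕ.^ i) / p ℕ.^ i) {{ℕ.m^n≢0 p i}}
  /-^ a p           zero    = refl
  /-^ a p@(suc _) (suc i) = trans (cong (+ a / p *_) (/-^ a p i)) (/-* a (a ℕ.^ i) p (p ℕ.^ i) {{_}} {{ℕ.m^n≢0 p i}})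

  /-nonNeg : ∀ a p .{{_ : ℕ.NonZero p}} → 0ℚ ≤ + a / p
  /-nonNeg a p = /-≤ 0 a 1 p ℕ.z≤n

  fromℕ-+ : ∀ a b → fromℕ (a ℕ.+ b) ≡ fromℕ a + fromℕ b
  fromℕ-+ a b = sym (/-+ a b 1)

  fromℕ-* : ∀ a b → fromℕ (a ℕ.* b) ≡ fromℕ a * fromℕ b
  fromℕ-* a b = sym (/-* a b 1 1)

  fromℕ-mono-≤ : ∀ {a b} → a ℕ.≤ b → fromℕ a ≤ fromℕ b
  fromℕ-mono-≤ {a} {b} a≤b = /-≤ a b 1 1 (ℕ.*-monoˡ-≤ 1 a≤b)

  *-nonNeg : ∀ {p q} → 0ℚ ≤ p → 0ℚ ≤ q → 0ℚ ≤ p * q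
  *-nonNeg {p} {q} p≥0 q≥0 =
    nonNegative⁻¹ (p * q) {{nonNeg*nonNeg⇒nonNeg p {{nonNegative p≥0}} q {{nonNegative q≥0}}}}

  ^-nonNeg : ∀ {p} i → 0ℚ ≤ p → 0ℚ ≤ p ^ i
  ^-nonNeg zero    p≥0 = /-nonNeg 1 1
  ^-nonNeg (suc i) p≥0 = *-nonNeg p≥0 (^-nonNeg i p≥0)

  *-monoʳ-≤-≥0 : ∀ {p q} r → 0ℚ ≤ r → p ≤ q → p * r ≤ q * r
  *-monoʳ-≤-≥0 r r≥0 = *-monoʳ-≤-nonNeg r {{nonNegative r≥0}}

  *-monoˡ-≤-≥0 : ∀ {p q} r → 0ℚ ≤ r → p ≤ q → r * p ≤ r * q
  *-monoˡ-≤-≥0 r r≥0 = *-monoˡ-≤-nonNeg r {{nonNegative r≥0}}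

  rising : ℕ → ℕ → ℕ
  rising M zero    = 1
  rising M (suc i) = rising M i ℕ.* (M ℕ.+ i)

  rising-suc : ∀ M i → rising M (suc i) ≡ M ℕ.* rising (suc M) i
  rising-suc M zero    = trans (ℕ.+-identityʳ (M ℕ.+ 0)) (trans (ℕ.+-identityʳ M) (sym (ℕ.*-identityʳ M)))
  rising-suc M (suc i) = begin
    rising M (suc i) ℕ.* (M ℕ.+ suc i)           ≡⟨ cong₂ ℕ._*_ (rising-suc M i) (ℕ.+-suc M i) ⟩
    M ℕ.* rising (suc M) i ℕ.* (suc M ℕ.+ i)     ≡⟨ ℕ.*-assoc M (rising (suc M) i) (suc M ℕ.+ i) ⟩
    M ℕ.* rising (suc M) (suc i)                 ∎
    where open ≡-Reasoning

  rising-0 : ∀ i → rising 0 (suc i) ≡ 0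
  rising-0 i = rising-suc 0 i

  invFactorial : ℕ → ℚ
  invFactorial zero    = 1ℚ
  invFactorial (suc i) = invFactorial i * (+ 1 / suc i)

  invFactorial-nonNeg : ∀ i → 0ℚ ≤ invFactorial i
  invFactorial-nonNeg zero    = /-nonNeg 1 1
  invFactorial-nonNeg (suc i) = *-nonNeg (invFactorial-nonNeg i) (/-nonNeg 1 (suc i))

  -- the coefficient of y ^ i in (1 - y) ^ -M
  negBinom : ℕ → ℕ → ℚ
  negBinom M i = fromℕ (rising M i) * invFactorial i

  negBinom-nonNeg : ∀ M i → 0ℚ ≤ negBinom M i
  negBinom-nonNeg M i = *-nonNeg (/-nonNeg (rising M i) 1) (invFactorial-nonNeg i)

  negBinom-pascal : ∀ M i → negBinom (suc M) (suc i) ≡ negBinom M (suc i) + negBinom (suc M) i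
  negBinom-pascal M i = begin
    fromℕ (r ℕ.* (suc M ℕ.+ i)) * (w * c)
      ≡⟨ cong (λ t → fromℕ (r ℕ.* t) * (w * c)) (sym (ℕ.+-suc M i)) ⟩
    fromℕ (r ℕ.* (M ℕ.+ suc i)) * (w * c)
      ≡⟨ cong (_* (w * c)) (trans (fromℕ-* r (M ℕ.+ suc i)) (cong (fromℕ r *_) (fromℕ-+ M (suc i)))) ⟩
    fromℕ r * (fromℕ M + fromℕ (suc i)) * (w * c)
      ≡⟨ solve 5 (λ r m j w c → r :* (m :+ j) :* (w :* c) := m :* r :* (w :* c) :+ r :* w :* (j :* c))
               refl (fromℕ r) (fromℕ M) (fromℕ (suc i)) w c ⟩
    fromℕ M * fromℕ r * (w * c) + fromℕ r * w * (fromℕ (suc i) * c)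
      ≡⟨ cong₂ _+_ (cong (_* (w * c)) (sym (trans (cong fromℕ (rising-suc M i)) (fromℕ-* M r))))
                   (trans (cong (fromℕ r * w *_) suc*inverse) (*-identityʳ (fromℕ r * w))) ⟩
    negBinom M (suc i) + negBinom (suc M) i ∎
    where
    open ≡-Reasoning
    open +-*-Solver
    r = rising (suc M) i
    w = invFactorial i
    c = + 1 / suc i
    suc*inverse : fromℕ (suc i) * c ≡ 1ℚ
    suc*inverse = trans (/-* (suc i) 1 1 (suc i)) (/-≡ (suc i ℕ.* 1) 1 (1 ℕ.* suc i) 1 (begin
      suc i ℕ.* 1 ℕ.* 1  ≡⟨ ℕ.*-identityʳ (suc i ℕ.* 1) ⟩
      suc i ℕ.* 1        ≡⟨ ℕ.*-comm (suc i) 1 ⟩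
      1 ℕ.* suc i        ≡⟨ ℕ.*-identityˡ (1 ℕ.* suc i) ⟨
      1 ℕ.* (1 ℕ.* suc i) ∎))

  negBinomSum : ℚ → ℕ → ℕ → ℚ
  negBinomSum y M zero    = 0ℚ
  negBinomSum y M (suc N) = negBinomSum y M N + negBinom M N * y ^ N

  negBinomSum-pascal : ∀ y M N →
    negBinomSum y (suc M) (suc N) ≡ negBinomSum y M (suc N) + y * negBinomSum y (suc M) N
  negBinomSum-pascal y M zero = solve 1 (λ y → con 0ℚ :+ con 1ℚ :* con 1ℚ := (con 0ℚ :+ con 1ℚ :* con 1ℚ) :+ y :* con 0ℚ) refl y
    where open +-*-Solver
  negBinomSum-pascal y M (suc N) = begin
    negBinomSum y (suc M) (suc N) + negBinom (suc M) (suc N) * (y * Y)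
      ≡⟨ cong₂ (λ u v → u + v * (y * Y)) (negBinomSum-pascal y M N) (negBinom-pascal M N) ⟩
    (A + y * B) + (a + b) * (y * Y)
      ≡⟨ solve 6 (λ A B a b Y y → (A :+ y :* B) :+ (a :+ b) :* (y :* Y) := (A :+ a :* (y :* Y)) :+ y :* (B :+ b :* Y))
               refl A B a b Y y ⟩
    (A + a * (y * Y)) + y * (B + b * Y) ∎
    where
    open ≡-Reasoning
    open +-*-Solver
    A = negBinomSum y M (suc N)
    B = negBinomSum y (suc M) N
    a = negBinom M (suc N)
    b = negBinom (suc M) N
    Y = y ^ N

  negBinomSum-0 : ∀ y N → negBinomSum y 0 (suc N) ≡ 1ℚ
  negBinomSum-0 y zero    = refl
  negBinomSum-0 y (suc N) = begin
    negBinomSum y 0 (suc N) + fromℕ (rising 0 (suc N)) * invFactorial (suc N) * y ^ suc N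
      ≡⟨ cong₂ (λ u v → u + fromℕ v * invFactorial (suc N) * y ^ suc N) (negBinomSum-0 y N) (rising-0 N) ⟩
    1ℚ + 0ℚ * invFactorial (suc N) * y ^ suc N
      ≡⟨ solve 2 (λ w Y → con 1ℚ :+ con 0ℚ :* w :* Y := con 1ℚ) refl (invFactorial (suc N)) (y ^ suc N) ⟩
    1ℚ ∎
    where
    open ≡-Reasoning
    open +-*-Solver

  module _ {y : ℚ} (y≥0 : 0ℚ ≤ y) where

    negBinomSum-mono : ∀ M N → negBinomSum y M N ≤ negBinomSum y M (suc N)
    negBinomSum-mono M N = ≤-trans (≤-reflexive (sym (+-identityʳ _)))
      (+-monoʳ-≤ (negBinomSum y M N) (*-nonNeg (negBinom-nonNeg M N) (^-nonNeg N y≥0)))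

    negBinomSum*^≤1 : ∀ {z} → 0ℚ ≤ z → y + z ≡ 1ℚ → ∀ M N → negBinomSum y M N * z ^ M ≤ 1ℚ
    negBinomSum*^≤1 {z} z≥0 y+z≡1 M zero = ≤-trans (≤-reflexive (*-zeroˡ (z ^ M))) (/-nonNeg 1 1)
    negBinomSum*^≤1 {z} z≥0 y+z≡1 zero (suc N) = ≤-reflexive (trans (*-identityʳ _) (negBinomSum-0 y N))
    negBinomSum*^≤1 {z} z≥0 y+z≡1 (suc M) (suc N) = begin
      T * (z * z ^ M) ≡⟨ solve 3 (λ T z Z → T :* (z :* Z) := (T :* z) :* Z) refl T z (z ^ M) ⟩
      (T * z) * z ^ M ≤⟨ *-monoʳ-≤-≥0 (z ^ M) (^-nonNeg M z≥0) T*z≤A ⟩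
      A * z ^ M       ≤⟨ negBinomSum*^≤1 z≥0 y+z≡1 M (suc N) ⟩
      1ℚ ∎
      where
      open ≤-Reasoning
      open +-*-Solver
      T = negBinomSum y (suc M) (suc N)
      A = negBinomSum y M (suc N)
      T≤A+y*T : T ≤ A + y * T
      T≤A+y*T = begin
        T                                        ≡⟨ negBinomSum-pascal y M N ⟩
        A + y * negBinomSum y (suc M) N          ≤⟨ +-monoʳ-≤ A (*-monoˡ-≤-≥0 y y≥0 (negBinomSum-mono (suc M) N)) ⟩
        A + y * T ∎
      T*z≤A : T * z ≤ A
      T*z≤A = begin
        T * z                       ≡⟨ solve 3 (λ T y z → T :* z := T :* (y :+ z) :- y :* T) refl T y z ⟩
        T * (y + z) - y * T         ≡⟨ cong (λ t → T * t - y * T) y+z≡1 ⟩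
        T * 1ℚ - y * T              ≤⟨ +-monoˡ-≤ (- (y * T)) (≤-trans (≤-reflexive (*-identityʳ T)) T≤A+y*T) ⟩
        A + y * T - y * T           ≡⟨ solve 3 (λ A y T → A :+ y :* T :- y :* T := A) refl A y T ⟩
        A ∎

    expTerm≤negBinom : ∀ M i → expTerm (fromℕ M * y) i ≤ negBinom M i * y ^ i
    expTerm≤negBinom M zero    = ≤-reflexive (sym (*-identityʳ 1ℚ))
    expTerm≤negBinom M (suc i) = begin
      expTerm x i * x * c                 ≤⟨ *-monoʳ-≤-≥0 c c≥0 (*-monoʳ-≤-≥0 x x≥0 (expTerm≤negBinom M i)) ⟩
      fromℕ r * w * Y * x * c             ≡⟨ solve 6 (λ r w Y m y c → r :* w :* Y :* (m :* y) :* c := m :* (r :* w :* Y :* y :* c))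
                                                   refl (fromℕ r) w Y (fromℕ M) y c ⟩
      fromℕ M * Q                         ≤⟨ *-monoʳ-≤-≥0 Q Q≥0 (fromℕ-mono-≤ (ℕ.m≤m+n M i)) ⟩
      fromℕ (M ℕ.+ i) * Q                 ≡⟨ solve 6 (λ r j w c Y y → j :* (r :* w :* Y :* y :* c) := r :* j :* (w :* c) :* (y :* Y))
                                                   refl (fromℕ r) (fromℕ (M ℕ.+ i)) w c Y y ⟩
      fromℕ r * fromℕ (M ℕ.+ i) * (w * c) * (y * Y) ≡⟨ cong (λ t → t * (w * c) * (y * Y)) (sym (fromℕ-* r (M ℕ.+ i))) ⟩
      negBinom M (suc i) * y ^ suc i ∎
      where
      open ≤-Reasoning
      open +-*-Solver
      x = fromℕ M * y
      c = + 1 / suc i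
      r = rising M i
      w = invFactorial i
      Y = y ^ i
      Q = fromℕ r * w * Y * y * c
      c≥0 : 0ℚ ≤ c
      c≥0 = /-nonNeg 1 (suc i)
      x≥0 : 0ℚ ≤ x
      x≥0 = *-nonNeg (/-nonNeg M 1) y≥0
      Q≥0 : 0ℚ ≤ Q
      Q≥0 = *-nonNeg (*-nonNeg (*-nonNeg (negBinom-nonNeg M i) (^-nonNeg i y≥0)) y≥0) c≥0

    expPartial≤negBinomSum : ∀ M N → expPartial (fromℕ M * y) N ≤ negBinomSum y M N
    expPartial≤negBinomSum M zero    = ≤-refl
    expPartial≤negBinomSum M (suc N) = +-mono-≤ (expPartial≤negBinomSum M N) (expTerm≤negBinom M N)

  -- With y = s / n and z = K / n = 1 - y the hypothesis reads (n / M) z ^ M ≥ 1, while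
  -- exp (M y) ≤ z ^ -M termwise against the series of (1 - y) ^ -M.
  lnBound : ∀ s K n m → s ℕ.+ K ≡ suc n →
            suc m ℕ.* suc n ℕ.^ suc m ℕ.≤ suc n ℕ.* K ℕ.^ suc m → LnBound s (suc n) (suc m)
  lnBound s zero n m _ hyp _ = contradiction hyp (ℕ.<⇒≱ (begin-strict
    suc n ℕ.* 0           ≡⟨ ℕ.*-zeroʳ (suc n) ⟩
    0                     <⟨ ℕ.m^n>0 (suc n) (suc m) ⟩
    suc n ℕ.^ suc m       ≤⟨ ℕ.m≤n*m (suc n ℕ.^ suc m) (suc m) ⟩
    suc m ℕ.* suc n ℕ.^ suc m ∎))
    where open ℕ.≤-Reasoning
  lnBound s K@(suc _) n m s+K≡n hyp N = *-cancelʳ-≤-pos (z ^ M) {{z^M>0}} (begin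
    expPartial (+ (s ℕ.* M) / suc n) N * z ^ M ≡⟨ cong (λ t → expPartial t N * z ^ M) x≡M*y ⟩
    expPartial (fromℕ M * y) N * z ^ M         ≤⟨ *-monoʳ-≤-≥0 (z ^ M) (^-nonNeg M z≥0) (expPartial≤negBinomSum y≥0 M N) ⟩
    negBinomSum y M N * z ^ M                  ≤⟨ negBinomSum*^≤1 y≥0 z≥0 y+z≡1 M N ⟩
    1ℚ                                         ≤⟨ 1≤n/M*z^M ⟩
    (+ suc n / M) * z ^ M ∎)
    where
    open ≤-Reasoning
    M = suc m
    y = + s / suc n
    z = + K / suc n
    y≥0 : 0ℚ ≤ y
    y≥0 = /-nonNeg s (suc n)
    z≥0 : 0ℚ ≤ z
    z≥0 = /-nonNeg K (suc n)
    instance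
      n^M≢0 : ℕ.NonZero (suc n ℕ.^ M)
      n^M≢0 = ℕ.m^n≢0 (suc n) M
    x≡M*y : + (s ℕ.* M) / suc n ≡ fromℕ M * y
    x≡M*y = sym (trans (/-* M s 1 (suc n)) (/-≡ (M ℕ.* s) (s ℕ.* M) (1 ℕ.* suc n) (suc n)
              (cong₂ ℕ._*_ (ℕ.*-comm M s) (sym (ℕ.*-identityˡ (suc n))))))
    y+z≡1 : y + z ≡ 1ℚ
    y+z≡1 = trans (/-+ s K (suc n)) (/-≡ (s ℕ.+ K) 1 (suc n) 1
              (trans (ℕ.*-identityʳ _) (trans s+K≡n (sym (ℕ.*-identityˡ (suc n))))))
    z^M>0 : Positive (z ^ M)
    z^M>0 = positive (subst (0ℚ <_) (sym (/-^ K (suc n) M))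
              (/-< 0 (K ℕ.^ M) 1 (suc n ℕ.^ M) (ℕ.<-≤-trans (ℕ.m^n>0 K M) (ℕ.≤-reflexive (sym (ℕ.*-identityʳ _))))))
    1≤n/M*z^M : 1ℚ ≤ (+ suc n / M) * z ^ M
    1≤n/M*z^M = subst (1ℚ ≤_) (sym (trans (cong (+ suc n / M *_) (/-^ K (suc n) M)) (/-* (suc n) (K ℕ.^ M) M (suc n ℕ.^ M))))
      (/-≤ 1 (suc n ℕ.* K ℕ.^ M) 1 (M ℕ.* suc n ℕ.^ M) {{_}} {{ℕ.m*n≢0 M (suc n ℕ.^ M)}}
        (ℕ.≤-trans (ℕ.≤-reflexive (ℕ.*-identityˡ _)) (ℕ.≤-trans hyp (ℕ.≤-reflexive (sym (ℕ.*-identityʳ _))))))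

open import Data.Nat as ℕ using (ℕ; zero; suc; _+_; _*_; _^_; _∸_; _≤_; _<_; _≤?_; z≤n; s≤s; pred; NonZero; ⌊_/2⌋)
open import Data.Nat.Properties
open import Data.Nat.Induction using (<-wellFounded)
open import Data.Nat.Solver using (module +-*-Solver)
open import Data.Bool using (Bool; true; not)
open import Data.Bool.Properties using (not-¬)
open import Data.Fin using (Fin; toℕ)
open import Data.Fin.Properties using (any?; toℕ-injective; toℕ≤pred[n]; toℕ<n; toℕ-inject₁; toℕ-fromℕ) renaming (_≟_ to _≟ᶠ_)
open import Data.Fin.Subset
open import Data.Fin.Subset.Properties
open import Data.Vec using (tabulate; _∷_; []; here; there)
open import Data.Vec.Properties using (lookup∘tabulate; []=⇒lookup; lookup⇒[]=)
open import Data.Product using (Σ; ∃; ∃-syntax; _×_; _,_; proj₁; proj₂)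
open import Data.Sum using (inj₁; inj₂; [_,_]′)
open import Function using (_∘_)
open import Induction.WellFounded as WF using (WfRec)
open import Level using (Level)
import Relation.Binary.Construct.On as On
open import Relation.Binary using (tri<; tri≈; tri>)
open import Relation.Binary.PropositionalEquality
open import Relation.Nullary using (yes; no; ¬_; does; contradiction; _×-dec_)
open import Relation.Nullary.Decidable using (dec-true; decidable-stable)
open import Relation.Unary using (Pred; Decidable)
open import Defs renaming (sym to adj-sym)
open +-*-Solver using (solve; _:*_; _:=_)
open ExponentialSeries using (lnBound)

private variable
  ℓ : Level
  n : ℕ

-- Growth ratios

^-distrib-* : ∀ a b n → (a * b) ^ n ≡ a ^ n * b ^ n
^-distrib-* a b zero    = refl
^-distrib-* a b (suc n) = begin
  a * b * (a * b) ^ n          ≡⟨ cong (a * b *_) (^-distrib-* a b n) ⟩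
  a * b * (a ^ n * b ^ n)      ≡⟨ solve 4 (λ a b x y → a :* b :* (x :* y) := a :* x :* (b :* y)) refl a b (a ^ n) (b ^ n) ⟩
  a * a ^ n * (b * b ^ n)      ∎
  where open ≡-Reasoning

-- s / b ≤ (N / c) ^ (1 / M), with the root cleared
RatioBound : (c N M s b : ℕ) → Set
RatioBound c N M s b = c * s ^ M ≤ N * b ^ M

RatioBound-mono : ∀ {c N M s s′ b b′} → s′ ≤ s → b ≤ b′ → RatioBound c N M s b → RatioBound c N M s′ b′
RatioBound-mono {c} {N} {M} s′≤s b≤b′ h =
  ≤-trans (*-monoʳ-≤ c (^-monoˡ-≤ M s′≤s)) (≤-trans h (*-monoʳ-≤ N (^-monoˡ-≤ M b≤b′)))

-- the summand with the larger ratio s / b already bounds the sum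
RatioBound-+-dominant : ∀ {c N M s₁ b₁ s₂ b₂} .{{_ : NonZero s₁}} → b₁ * s₂ ≤ b₂ * s₁ →
                        RatioBound c N M s₁ b₁ → RatioBound c N M (s₁ + s₂) (b₁ + b₂)
RatioBound-+-dominant {c} {N} {M} {s₁} {b₁} {s₂} {b₂} ord h₁ = *-cancelʳ-≤ _ _ (s₁ ^ M) {{m^n≢0 s₁ M}} (begin
  c * (s₁ + s₂) ^ M * s₁ ^ M        ≡⟨ solve 3 (λ c P Q → c :* P :* Q := c :* Q :* P) refl c ((s₁ + s₂) ^ M) (s₁ ^ M) ⟩
  c * s₁ ^ M * (s₁ + s₂) ^ M        ≤⟨ *-monoˡ-≤ ((s₁ + s₂) ^ M) h₁ ⟩
  N * b₁ ^ M * (s₁ + s₂) ^ M        ≡⟨ trans (*-assoc N _ _) (cong (N *_) (sym (^-distrib-* b₁ (s₁ + s₂) M))) ⟩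
  N * (b₁ * (s₁ + s₂)) ^ M          ≤⟨ *-monoʳ-≤ N (^-monoˡ-≤ M cross) ⟩
  N * ((b₁ + b₂) * s₁) ^ M          ≡⟨ trans (cong (N *_) (^-distrib-* (b₁ + b₂) s₁ M)) (sym (*-assoc N _ _)) ⟩
  N * (b₁ + b₂) ^ M * s₁ ^ M        ∎)
  where
  open ≤-Reasoning
  cross : b₁ * (s₁ + s₂) ≤ (b₁ + b₂) * s₁
  cross = begin
    b₁ * (s₁ + s₂)      ≡⟨ *-distribˡ-+ b₁ s₁ s₂ ⟩
    b₁ * s₁ + b₁ * s₂   ≤⟨ +-monoʳ-≤ (b₁ * s₁) ord ⟩
    b₁ * s₁ + b₂ * s₁   ≡⟨ *-distribʳ-+ s₁ b₁ b₂ ⟨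
    (b₁ + b₂) * s₁      ∎

RatioBound-+ : ∀ {c N M s₁ b₁ s₂ b₂} → RatioBound c N M s₁ b₁ → RatioBound c N M s₂ b₂ →
               RatioBound c N M (s₁ + s₂) (b₁ + b₂)
RatioBound-+ {c} {N} {M} {zero} {b₁} {s₂} {b₂} _ h₂ =
  ≤-trans h₂ (*-monoʳ-≤ N (^-monoˡ-≤ M (m≤n+m b₂ b₁)))
RatioBound-+ {c} {N} {M} {s₁@(suc _)} {b₁} {zero} {b₂} h₁ _ =
  subst (λ s → RatioBound c N M s (b₁ + b₂)) (sym (+-identityʳ s₁))
    (≤-trans h₁ (*-monoʳ-≤ N (^-monoˡ-≤ M (m≤m+n b₁ b₂))))
RatioBound-+ {c} {N} {M} {s₁@(suc _)} {b₁} {s₂@(suc _)} {b₂} h₁ h₂ with ≤-total (b₁ * s₂) (b₂ * s₁)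
... | inj₁ ord = RatioBound-+-dominant {c} {N} {M} {s₁} {b₁} {s₂} {b₂} ord h₁
... | inj₂ ord = subst₂ (RatioBound c N M) (+-comm s₂ s₁) (+-comm b₂ b₁) (RatioBound-+-dominant {c} {N} {M} {s₂} {b₂} {s₁} {b₁} ord h₂)

^-cancelˡ-≤ : ∀ n .{{_ : NonZero n}} {a b} → a ^ n ≤ b ^ n → a ≤ b
^-cancelˡ-≤ n a^n≤b^n = ≮⇒≥ (λ b<a → <⇒≱ (^-monoˡ-< n b<a) a^n≤b^n)

geometric-growth : ∀ {a b} (x : ℕ → ℕ) T → (∀ t → t < T → a * x t ≤ b * x (suc t)) →
                   a ^ T * x 0 ≤ b ^ T * x T
geometric-growth {a} {b} x zero    _    = ≤-refl
geometric-growth {a} {b} x (suc T) step = begin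
  a * a ^ T * x 0          ≡⟨ *-assoc a (a ^ T) (x 0) ⟩
  a * (a ^ T * x 0)        ≤⟨ *-monoʳ-≤ a (geometric-growth x T (λ t t<T → step t (m≤n⇒m≤1+n t<T))) ⟩
  a * (b ^ T * x T)        ≡⟨ solve 3 (λ a B y → a :* (B :* y) := B :* (a :* y)) refl a (b ^ T) (x T) ⟩
  b ^ T * (a * x T)        ≤⟨ *-monoʳ-≤ (b ^ T) (step T ≤-refl) ⟩
  b ^ T * (b * x (suc T))  ≡⟨ solve 3 (λ B b y → B :* (b :* y) := b :* B :* y) refl (b ^ T) b (x (suc T)) ⟩
  b * b ^ T * x (suc T)    ∎
  where open ≤-Reasoning

-- If β grew by a factor larger than (N / m) ^ (1 / m) at each of the radii m, …, 2m - 1,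
-- then β (2m) ≤ N would force β m ≤ m.
slow-growth-radius : ∀ {m N} .{{_ : NonZero m}} .{{_ : NonZero N}} (β : ℕ → ℕ) → m < β m → β (m + m) ≤ N →
                     ∃ λ t → t < m × RatioBound m N m (β (suc (m + t))) (β (m + t))
slow-growth-radius {m} {N} β m<βm β[m+m]≤N
  with anyUpTo? (λ t → m * β (suc (m + t)) ^ m ≤? N * β (m + t) ^ m) m
... | yes found = found
... | no  none  = contradiction m<βm (≤⇒≯ βm≤m)
  where
  fast : ∀ t → t < m → N * β (m + t) ^ m ≤ m * β (m + suc t) ^ m
  fast t t<m = subst (λ k → N * β (m + t) ^ m ≤ m * β k ^ m) (sym (+-suc m t))
                     (<⇒≤ (≰⇒> (λ slow → none (t , t<m , slow))))
  βm≤m : β m ≤ m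
  βm≤m = *-cancelˡ-≤ N (≤-trans (^-cancelˡ-≤ m (begin
    (N * β m) ^ m            ≡⟨ ^-distrib-* N (β m) m ⟩
    N ^ m * β m ^ m          ≡⟨ cong (λ k → N ^ m * β k ^ m) (sym (+-identityʳ m)) ⟩
    N ^ m * β (m + 0) ^ m    ≤⟨ geometric-growth (λ t → β (m + t) ^ m) m fast ⟩
    m ^ m * β (m + m) ^ m    ≤⟨ *-monoʳ-≤ (m ^ m) (^-monoˡ-≤ m β[m+m]≤N) ⟩
    m ^ m * N ^ m            ≡⟨ ^-distrib-* m N m ⟨
    (m * N) ^ m              ∎)) (≤-reflexive (*-comm m N)))
    where open ≤-Reasoning

∣p∣≡∣p∩q∣+∣p─q∣ : ∀ (p q : Subset n) → ∣ p ∣ ≡ ∣ p ∩ q ∣ + ∣ p ─ q ∣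
∣p∣≡∣p∩q∣+∣p─q∣ []            []            = refl
∣p∣≡∣p∩q∣+∣p─q∣ (inside  ∷ p) (inside  ∷ q) = cong suc (∣p∣≡∣p∩q∣+∣p─q∣ p q)
∣p∣≡∣p∩q∣+∣p─q∣ (inside  ∷ p) (outside ∷ q) = trans (cong suc (∣p∣≡∣p∩q∣+∣p─q∣ p q)) (sym (+-suc _ _))
∣p∣≡∣p∩q∣+∣p─q∣ (outside ∷ p) (inside  ∷ q) = ∣p∣≡∣p∩q∣+∣p─q∣ p q
∣p∣≡∣p∩q∣+∣p─q∣ (outside ∷ p) (outside ∷ q) = ∣p∣≡∣p∩q∣+∣p─q∣ p q

∣∁p∣+∣p∣≡n : ∀ (p : Subset n) → ∣ ∁ p ∣ + ∣ p ∣ ≡ n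
∣∁p∣+∣p∣≡n p = trans (cong (_+ ∣ p ∣) (∣∁p∣≡n∸∣p∣ p)) (m∸n+n≡m (∣p∣≤n p))

p⊆q∧∣q∣≤∣p∣⇒p≡q : ∀ {p q : Subset n} → p ⊆ q → ∣ q ∣ ≤ ∣ p ∣ → p ≡ q
p⊆q∧∣q∣≤∣p∣⇒p≡q {p = p} p⊆q ∣q∣≤∣p∣ = ⊆-antisym p⊆q λ {x} x∈q →
  decidable-stable (x ∈? p) (λ x∉p → <⇒≱ (p⊂q⇒∣p∣<∣q∣ (p⊆q , x , x∈q , x∉p)) ∣q∣≤∣p∣)

x∈p─q⇒x∉q : ∀ {p q : Subset n} {x} → x ∈ p ─ q → x ∉ q
x∈p─q⇒x∉q {p = _ ∷ _} {_ ∷ _} (there x∈) (there x∈q) = x∈p─q⇒x∉q x∈ x∈q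

⟦_⟧ : {P : Pred (Fin n) ℓ} → Decidable P → Subset n
⟦ P? ⟧ = tabulate (does ∘ P?)

∈⟦⟧⁺ : ∀ {P : Pred (Fin n) ℓ} (P? : Decidable P) {x} → P x → x ∈ ⟦ P? ⟧
∈⟦⟧⁺ P? {x} Px = lookup⇒[]= x _ (trans (lookup∘tabulate (does ∘ P?) x) (dec-true (P? x) Px))

∈⟦⟧⁻ : ∀ {P : Pred (Fin n) ℓ} (P? : Decidable P) {x} → x ∈ ⟦ P? ⟧ → P x
∈⟦⟧⁻ P? {x} x∈ with P? x | trans (sym (lookup∘tabulate (does ∘ P?) x)) ([]=⇒lookup x∈)
... | yes Px | _ = Px

-- Odd cycles

record Descent {n} (G : Graph n) (h : Fin n → ℕ) (D T : ℕ) (p : ℕ → Fin n) : Set where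
  field
    height : ∀ {t} → t ≤ T → h (p t) + t ≡ D
    edge   : ∀ {t} → t < T → Adj G (p t) (p (suc t))

-- The cycle runs down p and back up q; its vertices are distinct because heights separate the
-- steps of each walk, and the two walks first meet at step T.
descents⇒odd-cycle : ∀ {n} {G : Graph n} {h D T p q} → Descent G h D T p → Descent G h D T q →
                     Adj G (p 0) (q 0) → p T ≡ q T → (∀ {t} → t < T → p t ≢ q t) →
                     Cycle G (suc (2 * T))
descents⇒odd-cycle {G = G} {T = zero} _ _ p0~q0 meet _ = contradiction (subst (Adj G _) (sym meet) p0~q0) (irrefl G)
descents⇒odd-cycle {G = G} {h} {D} {T@(suc s)} {p} {q} P Q p0~q0 meet apart = record
  { m        = 2 * T
  ; len≡     = refl
  ; len≥3    = s≤s (*-monoʳ-≤ 2 (s≤s z≤n))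
  ; vert     = vertex ∘ toℕ
  ; distinct = λ {i} {j} eq → toℕ-injective (vertex-injective (toℕ≤pred[n] i) (toℕ≤pred[n] j) eq)
  ; step     = λ i → subst (λ a → Adj G (vertex a) (vertex (suc (toℕ i)))) (sym (toℕ-inject₁ i)) (vertex-edge (toℕ<n i))
  ; close    = subst (λ a → Adj G (vertex a) (vertex 0)) (sym (toℕ-fromℕ (2 * T))) closing-edge
  }
  where
  module P = Descent P
  module Q = Descent Q

  2T∸T≡T : 2 * T ∸ T ≡ T
  2T∸T≡T = trans (m+n∸m≡n T (T + 0)) (+-identityʳ T)

  mirror< : ∀ {a} → T < a → a ≤ 2 * T → 2 * T ∸ a < T
  mirror< {a} T<a a≤2T = subst (2 * T ∸ a <_) 2T∸T≡T (∸-monoʳ-< T<a a≤2T)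

  vertex : ℕ → Fin _
  vertex a with a ≤? T
  ... | yes _ = p a
  ... | no  _ = q (2 * T ∸ a)

  vertex-p : ∀ {a} → a ≤ T → vertex a ≡ p a
  vertex-p {a} a≤T with a ≤? T
  ... | yes _   = refl
  ... | no  a≰T = contradiction a≤T a≰T

  vertex-q : ∀ {a} → T ≤ a → vertex a ≡ q (2 * T ∸ a)
  vertex-q {a} T≤a with a ≤? T
  ... | no  _   = refl
  ... | yes a≤T = begin
    p a             ≡⟨ cong p a≡T ⟩
    p T             ≡⟨ meet ⟩
    q T             ≡⟨ cong q (trans (cong (2 * T ∸_) a≡T) 2T∸T≡T) ⟨
    q (2 * T ∸ a)   ∎
    where
    open ≡-Reasoning
    a≡T = ≤-antisym a≤T T≤a

  same-height : ∀ {x y a b} → x ≡ y → h x + a ≡ D → h y + b ≡ D → a ≡ b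
  same-height {x} refl ha hb = +-cancelˡ-≡ (h x) _ _ (trans ha (sym hb))

  p≢q-mirror : ∀ {a b} → a ≤ T → T < b → b ≤ 2 * T → p a ≢ q (2 * T ∸ b)
  p≢q-mirror a≤T T<b b≤2T eq = apart (subst (_< T) (sym a≡) (mirror< T<b b≤2T)) (trans eq (cong q (sym a≡)))
    where a≡ = same-height eq (P.height a≤T) (Q.height (<⇒≤ (mirror< T<b b≤2T)))

  vertex-injective : ∀ {a b} → a ≤ 2 * T → b ≤ 2 * T → vertex a ≡ vertex b → a ≡ b
  vertex-injective {a} {b} a≤2T b≤2T eq with a ≤? T | b ≤? T
  ... | yes a≤T | yes b≤T = same-height eq (P.height a≤T) (P.height b≤T)
  ... | yes a≤T | no  b≰T = contradiction eq (p≢q-mirror a≤T (≰⇒> b≰T) b≤2T)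
  ... | no  a≰T | yes b≤T = contradiction (sym eq) (p≢q-mirror b≤T (≰⇒> a≰T) a≤2T)
  ... | no  a≰T | no  b≰T = ∸-cancelˡ-≡ a≤2T b≤2T
    (same-height eq (Q.height (<⇒≤ (mirror< (≰⇒> a≰T) a≤2T))) (Q.height (<⇒≤ (mirror< (≰⇒> b≰T) b≤2T))))

  vertex-edge : ∀ {a} → a < 2 * T → Adj G (vertex a) (vertex (suc a))
  vertex-edge {a} a<2T with T ≤? a
  ... | no  T≰a = subst₂ (Adj G) (sym (vertex-p (<⇒≤ a<T))) (sym (vertex-p a<T)) (P.edge a<T)
    where a<T = ≰⇒> T≰a
  ... | yes T≤a = subst₂ (Adj G) (sym (trans (vertex-q T≤a) (cong q 2T∸a≡1+e))) (sym (vertex-q (m≤n⇒m≤1+n T≤a)))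
                    (adj-sym G (Q.edge e<T))
    where
    2T∸a≡1+e : 2 * T ∸ a ≡ suc (2 * T ∸ suc a)
    2T∸a≡1+e = +-∸-assoc 1 a<2T
    e<T : 2 * T ∸ suc a < T
    e<T = subst (_≤ T) 2T∸a≡1+e (subst (2 * T ∸ a ≤_) 2T∸T≡T (∸-monoʳ-≤ (2 * T) T≤a))

  closing-edge : Adj G (vertex (2 * T)) (vertex 0)
  closing-edge = subst₂ (Adj G) (sym (trans (vertex-q (m≤m+n T (T + 0))) (cong q (n∸n≡0 (2 * T))))) (sym (vertex-p z≤n))
                   (adj-sym G p0~q0)

-- Balls in induced subgraphs

module _ {P : Pred ℕ ℓ} (P? : Decidable P) where

  -- the least i ≤ b with P i, and b if there is none
  least : ℕ → ℕ
  least zero = zero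
  least (suc b) with P? (least b)
  ... | yes _ = least b
  ... | no  _ = suc b

  least-≤ : ∀ b → least b ≤ b
  least-≤ zero = z≤n
  least-≤ (suc b) with P? (least b)
  ... | yes _ = m≤n⇒m≤1+n (least-≤ b)
  ... | no  _ = ≤-refl

  least-satisfies : ∀ {j} b → P j → j ≤ b → P (least b)
  least-satisfies zero Pj z≤n = Pj
  least-satisfies {j} (suc b) Pj j≤1+b with P? (least b) | m≤n⇒m<n∨m≡n j≤1+b
  ... | yes Pl | _             = Pl
  ... | no ¬Pl | inj₁ (s≤s j≤b) = contradiction (least-satisfies b Pj j≤b) ¬Pl
  ... | no ¬Pl | inj₂ refl     = Pj

  least-minimal : ∀ {i} b → i < least b → ¬ P i
  least-minimal (suc b) i<l Pi with P? (least b)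
  ... | yes _  = least-minimal b i<l Pi
  ... | no ¬Pl = ¬Pl (least-satisfies b Pi (ℕ.s≤s⁻¹ i<l))

evenᵇ : ℕ → Bool
evenᵇ zero    = true
evenᵇ (suc k) = not (evenᵇ k)

module Ball {n} (G : Graph n) (A : Subset n) {v : Fin n} (v∈A : v ∈ A) where

  Boundary : Subset n → Pred (Fin n) _
  Boundary B u = u ∈ A × ∃[ w ] w ∈ B × Adj G u w

  boundary? : ∀ B → Decidable (Boundary B)
  boundary? B u = u ∈? A ×-dec any? (λ w → w ∈? B ×-dec adj? G u w)

  boundary : Subset n → Subset n
  boundary B = ⟦ boundary? B ⟧

  ball : ℕ → Subset n
  ball zero    = ⁅ v ⁆
  ball (suc j) = ball j ∪ boundary (ball j)

  ball-⊆-suc : ∀ j → ball j ⊆ ball (suc j)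
  ball-⊆-suc j = p⊆p∪q (boundary (ball j))

  ball-mono : ∀ {i j} → i ≤ j → ball i ⊆ ball j
  ball-mono {j = zero}  z≤n = ⊆-refl
  ball-mono {j = suc j} i≤1+j with m≤n⇒m<n∨m≡n i≤1+j
  ... | inj₁ (s≤s i≤j) = ⊆-trans (ball-mono i≤j) (ball-⊆-suc j)
  ... | inj₂ refl      = ⊆-refl

  v∈ball : ∀ j → v ∈ ball j
  v∈ball j = ball-mono {j = j} z≤n (x∈⁅x⁆ v)

  ball⊆A : ∀ j → ball j ⊆ A
  ball⊆A zero    u∈⁅v⁆ = subst (_∈ A) (sym (x∈⁅y⁆⇒x≡y v u∈⁅v⁆)) v∈A
  ball⊆A (suc j) u∈    with x∈p∪q⁻ (ball j) _ u∈
  ... | inj₁ u∈ball = ball⊆A j u∈ball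
  ... | inj₂ u∈∂    = proj₁ (∈⟦⟧⁻ (boundary? (ball j)) u∈∂)

  ball-step : ∀ {j u w} → w ∈ ball j → u ∈ A → Adj G u w → u ∈ ball (suc j)
  ball-step {j} w∈ u∈A u~w = q⊆p∪q (ball j) _ (∈⟦⟧⁺ (boundary? (ball j)) (u∈A , _ , w∈ , u~w))

  ball-suc⁻ : ∀ {j u} → u ∈ ball (suc j) → u ∉ ball j → ∃[ w ] w ∈ ball j × Adj G u w
  ball-suc⁻ {j} u∈ u∉ with x∈p∪q⁻ (ball j) _ u∈
  ... | inj₁ u∈ball = contradiction u∈ball u∉
  ... | inj₂ u∈∂    = proj₂ (∈⟦⟧⁻ (boundary? (ball j)) u∈∂)

  ball-stable : ∀ {j} → ball j ≡ ball (suc j) → ∀ t → ball (t + j) ≡ ball (suc t + j)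
  ball-stable eq zero    = eq
  ball-stable eq (suc t) = cong (λ B → B ∪ boundary B) (ball-stable eq t)

  ∣ball∣-growing : ∀ {m} → ∣ ball m ∣ < ∣ ball (suc m) ∣ → ∀ j → j ≤ m → j < ∣ ball j ∣
  ∣ball∣-growing {m} grows zero    _     = subst (0 <_) (sym (∣⁅x⁆∣≡1 v)) ℕ.z<s
  ∣ball∣-growing {m} grows (suc j) 1+j≤m =
    <-≤-trans (s≤s (∣ball∣-growing grows j j≤m)) (strict j≤m)
    where
    j≤m = ≤-trans (n≤1+n j) 1+j≤m
    strict : ∀ {j} → j ≤ m → ∣ ball j ∣ < ∣ ball (suc j) ∣
    strict {j} j≤m with m≤n⇒m<n∨m≡n (p⊆q⇒∣p∣≤∣q∣ (ball-⊆-suc j))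
    ... | inj₁ lt = lt
    ... | inj₂ eq = contradiction (cong ∣_∣ stuck) (<⇒≢ grows)
      where
      stuck : ball m ≡ ball (suc m)
      stuck = subst (λ k → ball k ≡ ball (suc k)) (m∸n+n≡m j≤m)
                (ball-stable (p⊆q∧∣q∣≤∣p∣⇒p≡q (ball-⊆-suc j) (≤-reflexive (sym eq))) (m ℕ.∸ j))

  module Depth (r : ℕ) where

    depth : Fin n → ℕ
    depth u = least (λ j → u ∈? ball j) r

    depth≤r : ∀ u → depth u ≤ r
    depth≤r u = least-≤ (λ j → u ∈? ball j) r

    ∈-ball-depth : ∀ {u} → u ∈ ball r → u ∈ ball (depth u)
    ∈-ball-depth {u} u∈ = least-satisfies (λ j → u ∈? ball j) r u∈ ≤-refl

    depth-minimal : ∀ {u j} → j < depth u → u ∉ ball j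
    depth-minimal {u} = least-minimal (λ j → u ∈? ball j) r

    depth-≤ : ∀ {u j} → u ∈ ball j → depth u ≤ j
    depth-≤ u∈ = ≮⇒≥ (λ j<depth → depth-minimal j<depth u∈)

    -- a neighbour one layer further in; u itself when there is none
    parent : Fin n → Fin n
    parent u with any? (λ w → w ∈? ball (pred (depth u)) ×-dec adj? G u w)
    ... | yes (w , _) = w
    ... | no  _       = u

    record IsParent (u w : Fin n) (j : ℕ) : Set where
      field
        ∈-ball : w ∈ ball r
        adj    : Adj G u w
        depth≡ : depth w ≡ j

    parent-spec : ∀ {u j} → u ∈ ball r → depth u ≡ suc j → IsParent u (parent u) j
    parent-spec {u} {j} u∈ depth≡1+j
      with any? (λ w → w ∈? ball (pred (depth u)) ×-dec adj? G u w)
    ... | no none = contradiction (subst (λ k → ∃[ w ] w ∈ ball (pred k) × Adj G u w) (sym depth≡1+j) inner) none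
      where
      inner : ∃[ w ] w ∈ ball j × Adj G u w
      inner = ball-suc⁻ {j = j} (subst (λ k → u ∈ ball k) depth≡1+j (∈-ball-depth u∈))
                        (depth-minimal (subst (j <_) (sym depth≡1+j) ≤-refl))
    ... | yes (w , w∈ , u~w) = record
      { ∈-ball = ball-mono j≤r w∈j
      ; adj    = u~w
      ; depth≡ = ≤-antisym (depth-≤ {j = j} w∈j) (≮⇒≥ too-shallow)
      }
      where
      w∈j : w ∈ ball j
      w∈j = subst (λ k → w ∈ ball (pred k)) depth≡1+j w∈
      j≤r : j ≤ r
      j≤r = ≤-trans (n≤1+n j) (subst (_≤ r) depth≡1+j (depth≤r u))
      too-shallow : ¬ depth w < j
      too-shallow d<j = depth-minimal (subst (j <_) (sym depth≡1+j) ≤-refl)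
        (ball-mono d<j (ball-step {j = depth w} (∈-ball-depth (ball-mono j≤r w∈j)) (ball⊆A r u∈) u~w))

    ancestor : Fin n → ℕ → Fin n
    ancestor u zero    = u
    ancestor u (suc t) = parent (ancestor u t)

    private
      +-<⇒suc : ∀ {x t d} → x + t ≡ d → t < d → ∃[ j ] x ≡ suc j
      +-<⇒suc {zero}  refl t<t = contradiction t<t (n≮n _)
      +-<⇒suc {suc j} _    _   = j , refl

      ancestor-spec : ∀ {u t} → u ∈ ball r → t ≤ depth u → ancestor u t ∈ ball r × depth (ancestor u t) + t ≡ depth u
      ancestor-spec {u} {zero}  u∈ _ = u∈ , +-identityʳ (depth u)
      ancestor-spec {u} {suc t} u∈ t<depth with ancestor-spec {t = t} u∈ (<⇒≤ t<depth)
      ... | a∈ , height with +-<⇒suc height t<depth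
      ... | j , eq = IsParent.∈-ball pa , trans (cong (_+ suc t) (IsParent.depth≡ pa)) (trans (+-suc j t) (subst (λ x → x + t ≡ _) eq height))
        where pa = parent-spec a∈ eq

    ancestor-descent : ∀ {u T} → u ∈ ball r → T ≤ depth u → Descent G depth (depth u) T (ancestor u)
    ancestor-descent {u} u∈ T≤depth = record
      { height = λ t≤T → proj₂ (ancestor-spec u∈ (≤-trans t≤T T≤depth))
      ; edge   = edge
      }
      where
      edge : ∀ {t} → t < _ → Adj G (ancestor u t) (ancestor u (suc t))
      edge {t} t<T with ancestor-spec {t = t} u∈ (≤-trans (<⇒≤ t<T) T≤depth)
      ... | a∈ , height = IsParent.adj (parent-spec a∈ (proj₂ (+-<⇒suc height (<-≤-trans t<T T≤depth))))

    ancestor-root : ∀ {u} → u ∈ ball r → ancestor u (depth u) ≡ v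
    ancestor-root {u} u∈ with ancestor-spec {t = depth u} u∈ ≤-refl
    ... | a∈ , height = x∈⁅y⁆⇒x≡y v (subst (λ k → ancestor u (depth u) ∈ ball k) depth≡0 (∈-ball-depth a∈))
      where depth≡0 = +-cancelʳ-≡ (depth u) (depth (ancestor u (depth u))) 0 height

    same-depth⇒odd-cycle : ∀ {u w} → u ∈ ball r → w ∈ ball r → Adj G u w → depth u ≡ depth w →
                           ∃[ T ] T ≤ r × Cycle G (suc (2 * T))
    same-depth⇒odd-cycle {u} {w} u∈ w∈ u~w du≡dw =
      T , ≤-trans T≤D (depth≤r u) , descents⇒odd-cycle U W u~w meet (least-minimal meets? D)
      where
      D = depth u
      meets? = λ t → ancestor u t ≟ᶠ ancestor w t
      T = least meets? D
      T≤D = least-≤ meets? D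
      meet : ancestor u T ≡ ancestor w T
      meet = least-satisfies meets? D
               (trans (ancestor-root u∈) (sym (trans (cong (ancestor w) du≡dw) (ancestor-root w∈)))) ≤-refl
      U = ancestor-descent u∈ T≤D
      W = subst (λ d → Descent G depth d T (ancestor w)) (sym du≡dw)
                (ancestor-descent w∈ (subst (T ≤_) du≡dw T≤D))

    private
      deeper-neighbour : ∀ {u w} → u ∈ ball r → w ∈ ball r → Adj G u w → depth u < depth w → depth w ≡ suc (depth u)
      deeper-neighbour {u} {w} u∈ w∈ u~w du<dw = ≤-antisym
        (depth-≤ {j = suc (depth u)} (ball-step {j = depth u} (∈-ball-depth u∈) (ball⊆A r w∈) (adj-sym G u~w))) du<dw

    depth-parity-proper : (∀ T → T ≤ r → ¬ Cycle G (suc (2 * T))) →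
                          ∀ {u w} → u ∈ ball r → w ∈ ball r → Adj G u w → evenᵇ (depth u) ≢ evenᵇ (depth w)
    depth-parity-proper no-short {u} {w} u∈ w∈ u~w with <-cmp (depth u) (depth w)
    ... | tri≈ _ du≡dw _ = contradiction (proj₂ (proj₂ cyc)) (no-short _ (proj₁ (proj₂ cyc)))
      where cyc = same-depth⇒odd-cycle u∈ w∈ u~w du≡dw
    ... | tri< du<dw _ _ = subst (λ d → evenᵇ (depth u) ≢ evenᵇ d) (sym (deeper-neighbour u∈ w∈ u~w du<dw)) (not-¬ refl)
    ... | tri> _ _ dw<du = subst (λ d → evenᵇ d ≢ evenᵇ (depth w)) (sym (deeper-neighbour w∈ u∈ (adj-sym G u~w) dw<du))
                                 (not-¬ refl ∘ sym)

module Decomposition {n} (G : Graph n) (m : ℕ) .{{_ : NonZero m}} (m≤n : m ≤ n)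
    (no-short-odd-cycle : ∀ T → T < m + m → ¬ Cycle G (suc (2 * T))) where

  ProperOn : Subset n → (Fin n → Bool) → Set
  ProperOn K c = ∀ {u w} → u ∈ K → w ∈ K → Adj G u w → c u ≢ c w

  record LargeBipartite (A : Subset n) : Set where
    field
      kept   : Subset n
      kept⊆A : kept ⊆ A
      colour : Fin n → Bool
      proper : ProperOn kept colour
      large  : RatioBound m n m ∣ A ∣ ∣ kept ∣

  private instance
    n≢0 : NonZero n
    n≢0 = ℕ.>-nonZero (<-≤-trans (ℕ.>-nonZero⁻¹ m) m≤n)

  module _ {A : Subset n} {v : Fin n} (v∈A : v ∈ A) where
    open Ball G A v∈A

    good-radius : ∃[ r ] r < m + m × RatioBound m n m ∣ ball (suc r) ∣ ∣ ball r ∣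
    good-radius with m≤n⇒m<n∨m≡n (p⊆q⇒∣p∣≤∣q∣ (ball-⊆-suc m))
    ... | inj₂ stalled = m , m<m+n m (ℕ.>-nonZero⁻¹ m) ,
                         subst (λ b → RatioBound m n m b ∣ ball m ∣) stalled (*-monoˡ-≤ (∣ ball m ∣ ^ m) m≤n)
    ... | inj₁ growing with slow-growth-radius {m} {n} (λ j → ∣ ball j ∣) (∣ball∣-growing growing m ≤-refl) (∣p∣≤n (ball (m + m)))
    ...   | t , t<m , slow = m + t , +-monoʳ-< m t<m , slow

    -- Keep the ball of radius r, coloured by depth parity, delete the sphere around it, and
    -- recurse on the rest of A, which has no edge to the ball.
    module Peel (rec : ∀ A′ → ∣ A′ ∣ < ∣ A ∣ → LargeBipartite A′) where
      r      = proj₁ good-radius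
      r<m+m  = proj₁ (proj₂ good-radius)
      slow   = proj₂ (proj₂ good-radius)
      open Depth r

      inner outer rest : Subset n
      inner = ball r
      outer = ball (suc r)
      rest  = A ─ outer

      module R = LargeBipartite (rec rest (p∩q≢∅⇒∣p─q∣<∣p∣ A outer (v , x∈p∩q⁺ (v∈A , v∈ball (suc r)))))

      kept : Subset n
      kept = inner ∪ R.kept

      colour : Fin n → Bool
      colour u with u ∈? inner
      ... | yes _ = evenᵇ (depth u)
      ... | no  _ = R.colour u

      colour-inner : ∀ {u} → u ∈ inner → colour u ≡ evenᵇ (depth u)
      colour-inner {u} u∈ with u ∈? inner
      ... | yes _ = refl
      ... | no u∉ = contradiction u∈ u∉

      R-kept-outside : ∀ {u} → u ∈ R.kept → u ∈ A × u ∉ outer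
      R-kept-outside u∈ = p─q⊆p A outer (R.kept⊆A u∈) , x∈p─q⇒x∉q (R.kept⊆A u∈)

      colour-rest : ∀ {u} → u ∈ R.kept → colour u ≡ R.colour u
      colour-rest {u} u∈ with u ∈? inner
      ... | yes u∈inner = contradiction (ball-⊆-suc r u∈inner) (proj₂ (R-kept-outside u∈))
      ... | no  _       = refl

      no-edge-inner-rest : ∀ {u w} → u ∈ inner → w ∈ R.kept → ¬ Adj G u w
      no-edge-inner-rest u∈ w∈ u~w with R-kept-outside w∈
      ... | w∈A , w∉outer = w∉outer (ball-step {j = r} u∈ w∈A (adj-sym G u~w))

      proper : ProperOn kept colour
      proper {u} {w} u∈ w∈ u~w with x∈p∪q⁻ inner R.kept u∈ | x∈p∪q⁻ inner R.kept w∈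
      ... | inj₁ u∈inner | inj₁ w∈inner = subst₂ _≢_ (sym (colour-inner u∈inner)) (sym (colour-inner w∈inner))
        (depth-parity-proper (λ T T≤r → no-short-odd-cycle T (≤-<-trans T≤r r<m+m)) u∈inner w∈inner u~w)
      ... | inj₁ u∈inner | inj₂ w∈rest  = contradiction u~w (no-edge-inner-rest u∈inner w∈rest)
      ... | inj₂ u∈rest  | inj₁ w∈inner = contradiction (adj-sym G u~w) (no-edge-inner-rest w∈inner u∈rest)
      ... | inj₂ u∈rest  | inj₂ w∈rest  = subst₂ _≢_ (sym (colour-rest u∈rest)) (sym (colour-rest w∈rest)) (R.proper u∈rest w∈rest u~w)

      ∣A∣≤∣outer∣+∣rest∣ : ∣ A ∣ ≤ ∣ outer ∣ + ∣ rest ∣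
      ∣A∣≤∣outer∣+∣rest∣ = ≤-trans (≤-reflexive (∣p∣≡∣p∩q∣+∣p─q∣ A outer)) (+-monoˡ-≤ ∣ rest ∣ (∣p∩q∣≤∣q∣ A outer))

      ∣inner∣+∣R∣≤∣kept∣ : ∣ inner ∣ + ∣ R.kept ∣ ≤ ∣ kept ∣
      ∣inner∣+∣R∣≤∣kept∣ = ≤-trans
        (+-mono-≤ (p⊆q⇒∣p∣≤∣q∣ (λ u∈ → x∈p∩q⁺ (p⊆p∪q R.kept u∈ , ball-⊆-suc r u∈)))
                  (p⊆q⇒∣p∣≤∣q∣ (λ u∈ → x∈p∧x∉q⇒x∈p─q (q⊆p∪q inner R.kept u∈) (proj₂ (R-kept-outside u∈)))))
        (≤-reflexive (sym (∣p∣≡∣p∩q∣+∣p─q∣ kept outer)))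

      result : LargeBipartite A
      result = record
        { kept   = kept
        ; kept⊆A = λ u∈ → [ ball⊆A r , proj₁ ∘ R-kept-outside ]′ (x∈p∪q⁻ inner R.kept u∈)
        ; colour = colour
        ; proper = proper
        ; large  = RatioBound-mono {m} {n} {m} ∣A∣≤∣outer∣+∣rest∣ ∣inner∣+∣R∣≤∣kept∣
                     (RatioBound-+ {m} {n} {m} {∣ outer ∣} {∣ inner ∣} {∣ rest ∣} {∣ R.kept ∣}
                                   slow R.large)
        }

  largeBipartite : ∀ A → LargeBipartite A
  largeBipartite = WF.All.wfRec (On.wellFounded ∣_∣ <-wellFounded) _ LargeBipartite peel
    where
    peel : ∀ A → WfRec (λ p q → ∣ p ∣ < ∣ q ∣) LargeBipartite A → LargeBipartite A
    peel A rec with nonempty? A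
    ... | yes (v , v∈A) = Peel.result v∈A (λ A′ → rec)
    ... | no  empty     = record
      { kept = A ; kept⊆A = ⊆-refl ; colour = λ _ → true
      ; proper = λ u∈ → contradiction (_ , u∈) empty
      ; large = *-monoˡ-≤ (∣ A ∣ ^ m) m≤n
      }

theorem1p4 : (n : ℕ) (G : Graph n) (k : ℕ) → 2 ≤ k → ⌊ k /2⌋ ≤ n
    → (∀ L → Odd L → Cycle G L → 2 * k + 1 < L)
    → Σ (Subset n) λ X → LnBound ∣ X ∣ n ⌊ k /2⌋
    × Σ (Fin n → Bool) λ c → ∀ u v → u ∉ X → v ∉ X → Adj G u v → c u ≢ c v
theorem1p4 (suc n) G k@(suc (suc k′)) (s≤s (s≤s z≤n)) m≤n no-odd-cycle≤2k+1 =
  ∁ B.kept , size-bound , B.colour , λ u w u∉X w∉X → B.proper (x∉∁p⇒x∈p u∉X) (x∉∁p⇒x∈p w∉X)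
  where
  m = ⌊ k /2⌋
  m+m≤k : m + m ≤ k
  m+m≤k = ≤-trans (+-monoʳ-≤ m (⌊n/2⌋≤⌈n/2⌉ k)) (≤-reflexive (⌊n/2⌋+⌈n/2⌉≡n k))
  no-short-odd-cycle : ∀ T → T < m + m → ¬ Cycle G (suc (2 * T))
  no-short-odd-cycle T T<2m cycle = <⇒≱ (no-odd-cycle≤2k+1 _ (T , refl) cycle)
    (≤-trans (s≤s (*-monoʳ-≤ 2 (<⇒≤ (<-≤-trans T<2m m+m≤k)))) (≤-reflexive (+-comm 1 (2 * k))))
  module B = Decomposition.LargeBipartite (Decomposition.largeBipartite G m m≤n no-short-odd-cycle ⊤)
  size-bound : LnBound ∣ ∁ B.kept ∣ (suc n) m
  size-bound = lnBound ∣ ∁ B.kept ∣ ∣ B.kept ∣ n ⌊ k′ /2⌋ (∣∁p∣+∣p∣≡n B.kept)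
                 (subst (λ a → m * a ^ m ≤ suc n * ∣ B.kept ∣ ^ m) (∣⊤∣≡n (suc n)) B.large)
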